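{- Let $p$ be a prime power and let $G(p)$ be the bipartite point–line incidence graph of a projective plane of order $p$: its $n = 2(p^2+p+1)$ vertices are the $p^2+p+1$ points and the $p^2+p+1$ lines of the plane, and a point is adjacent to a line iff the point lies on the line (so $G(p)$ is $(p+1)$-regular and contains no $K_{2,2}$). Then \[ \chi_{2K_2}(G(p)) \geq \sqrt{\frac{2(p^2+p+1)(p+1)}{2p+1}} + \frac12 \geq \sqrt{\frac{n}{2} + \frac{\sqrt{n}}{4}} + \frac12 . \]
   Context: All graphs are finite and simple. $2K_2$ denotes the graph consisting of two disjoint edges. For a fixed bipartite graph $H$, a proper vertex coloring of a graph $G$ is called an $H$-avoiding coloring if for any two color classes, the subgraph of $G$ induced by their union contains no induced subgraph isomorphic to $H$. $\chi_H(G)$ denotes the minimum number of colors in an $H$-avoiding coloring of $G$. -}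

module Defs where

open import Data.Nat using (ℕ; zero; suc; _+_; _*_; _≤_; _^_)
open import Data.Nat.Primality using (Prime)
open import Data.Fin using (Fin; zero; suc)
open import Data.Bool using (Bool; true; false; T)
open import Data.Sum using (_⊎_; inj₁; inj₂)
open import Data.Product using (Σ; ∃; ∃-syntax; _×_; _,_; ∃!)
open import Data.Empty using (⊥)
open import Relation.Nullary using (¬_)
open import Relation.Binary.PropositionalEquality using (_≡_)

IsPrimePower : ℕ → Set
IsPrimePower p = ∃[ q ] ∃[ k ] (Prime q × 1 ≤ k × p ≡ q ^ k)

countTrue : ∀ {n} → (Fin n → Bool) → ℕ
countTrue {zero}  f = 0
countTrue {suc n} f with f zero
... | true  = suc (countTrue (λ i → f (suc i)))
... | false = countTrue (λ i → f (suc i))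

planeSize : ℕ → ℕ
planeSize p = p * p + p + 1

-- A projective plane of order p, with points Fin (p²+p+1) and lines Fin (p²+p+1);
-- inc x L = true iff point x lies on line L.
record ProjectivePlane (p : ℕ) : Set where
  field
    inc : Fin (planeSize p) → Fin (planeSize p) → Bool
    two-points : ∀ x y → ¬ x ≡ y → ∃! _≡_ (λ L → T (inc x L) × T (inc y L))
    two-lines : ∀ L M → ¬ L ≡ M → ∃! _≡_ (λ x → T (inc x L) × T (inc x M))
    line-size : ∀ L → countTrue (λ x → inc x L) ≡ suc p
    point-degree : ∀ x → countTrue (λ L → inc x L) ≡ suc p

record Graph : Set₁ where
  field
    V   : Set
    Adj : V → V → Set
    sym : ∀ {u v} → Adj u v → Adj v u
    irrefl : ∀ {v} → ¬ Adj v v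

IncAdj : ∀ {p} → ProjectivePlane p →
         Fin (planeSize p) ⊎ Fin (planeSize p) → Fin (planeSize p) ⊎ Fin (planeSize p) → Set
IncAdj P (inj₁ x) (inj₂ L) = T (ProjectivePlane.inc P x L)
IncAdj P (inj₂ L) (inj₁ x) = T (ProjectivePlane.inc P x L)
IncAdj P (inj₁ _) (inj₁ _) = ⊥
IncAdj P (inj₂ _) (inj₂ _) = ⊥

incidenceGraph : ∀ {p} → ProjectivePlane p → Graph
incidenceGraph {p} P = record
  { V = Fin (planeSize p) ⊎ Fin (planeSize p)
  ; Adj = IncAdj P
  ; sym = λ { {inj₁ x} {inj₂ L} e → e ; {inj₂ L} {inj₁ x} e → e
            ; {inj₁ _} {inj₁ _} () ; {inj₂ _} {inj₂ _} () }
  ; irrefl = λ { {inj₁ _} () ; {inj₂ _} () }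
  }

module _ (G : Graph) where
  open Graph G

  IsProper : ∀ {k} → (V → Fin k) → Set
  IsProper c = ∀ u v → Adj u v → ¬ c u ≡ c v

  InClasses : ∀ {k} → (V → Fin k) → Fin k → Fin k → V → Set
  InClasses col i j v = col v ≡ i ⊎ col v ≡ j

  Induced2K2 : ∀ {k} → (V → Fin k) → Fin k → Fin k → Set
  Induced2K2 col i j =
    ∃[ a ] ∃[ b ] ∃[ c ] ∃[ d ]
      ( InClasses col i j a × InClasses col i j b
      × InClasses col i j c × InClasses col i j d
      × ¬ a ≡ b × ¬ a ≡ c × ¬ a ≡ d × ¬ b ≡ c × ¬ b ≡ d × ¬ c ≡ d
      × Adj a b × Adj c d
      × ¬ Adj a c × ¬ Adj a d × ¬ Adj b c × ¬ Adj b d )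

  Is2K2Avoiding : ∀ {k} → (V → Fin k) → Set
  Is2K2Avoiding col = IsProper col × (∀ i j → ¬ i ≡ j → ¬ Induced2K2 col i j)

  -- "χ_{2K₂}(G) ≥ bound" for a predicate on the number of colours:
  -- every 2K₂-avoiding colouring with k colours has k satisfying the bound
  -- (i.e. the bound holds for the minimum, as the bounds used are upward closed)
  χ2K2-satisfies : (ℕ → Set) → Set
  χ2K2-satisfies Bound = ∀ k (col : V → Fin k) → Is2K2Avoiding col → Bound k

{-# OPTIONS --safe #-}
-- Fix a 2K₂-avoiding colouring with k colours and two colours i ≠ j. The incidences between
-- the classes i and j form a bipartite graph with no C₄ (two lines meet in one point) and no
-- induced 2K₂, and such a graph is a double star: all its edges meet a point u or a line v
-- through u. Hence it has at most (p + 1) + p = 2p + 1 edges. Every one of the N(p + 1)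
-- incidences joins two distinct colours, so summing over the pairs of colours gives
-- 2N(p + 1) ≤ k(k - 1)(2p + 1), which rearranges to the stated bounds.
module Submission where

open import Defs
open import Data.Nat using (ℕ; zero; suc; _+_; _*_; _∸_; _≤_; z≤n; s≤s)
open import Data.Nat.Properties
  using ( +-*-semiring; +-mono-≤; +-identityʳ; +-comm; +-cancelʳ-≤; suc-injective
        ; ≤-trans; ≤-reflexive; m≤m+n; m+n≤o⇒m≤o; m+n≤o⇒n≤o; m+n≤o⇒m≤o∸n
        ; *-suc; *-distribˡ-+; *-distribˡ-∸; *-monoʳ-≤; *-monoˡ-≤; *-mono-≤; *-cancelˡ-≤
        ; module ≤-Reasoning )
open import Data.Nat.Tactic.RingSolver using (solve-∀)
open import Data.Bool using (Bool; true; false; T; not; _∧_)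
open import Data.Fin using (Fin; zero; suc; _≟_)
open import Data.Fin.Properties using (any?)
open import Data.Product using (_×_; ∃₂; _,_; proj₁; proj₂)
open import Data.Sum using (_⊎_; inj₁; inj₂; [_,_]′)
open import Data.Sum.Properties using (inj₁-injective; inj₂-injective)
open import Data.Empty using (⊥; ⊥-elim)
open import Function using (_∘_)
open import Relation.Nullary using (¬_; Dec; yes; no; does; _×-dec_; _⊎-dec_; ¬?)
open import Relation.Nullary.Decidable using (T?)
open import Relation.Binary.PropositionalEquality
  using (_≡_; _≢_; ≢-sym; refl; sym; trans; cong; cong₂; subst; module ≡-Reasoning)
open import Algebra.Properties.Semiring.Sum +-*-semiring
  using (sum; sum-syntax; ∑-comm; ∑-distrib-+; sum-cong-≗; sum-replicate-zero; *-distribˡ-sum)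

𝟙 : Bool → ℕ
𝟙 true  = 1
𝟙 false = 0

𝟙-T : ∀ {b} → T b → 𝟙 b ≡ 1
𝟙-T {true} _ = refl

𝟙-F : ∀ {b} → ¬ T b → 𝟙 b ≡ 0
𝟙-F {false} _  = refl
𝟙-F {true}  ¬t = ⊥-elim (¬t _)

𝟙-∧ : ∀ a b → 𝟙 (a ∧ b) ≡ 𝟙 a * 𝟙 b
𝟙-∧ true  b = sym (+-identityʳ (𝟙 b))
𝟙-∧ false b = refl

𝟙-split : ∀ b m → 𝟙 b * m + 𝟙 (not b) * m ≡ m
𝟙-split true  m = trans (+-identityʳ _) (+-identityʳ m)
𝟙-split false m = +-identityʳ m

𝟙-disjoint-≤ : ∀ {a b s} → ¬ (T a × T b) → (T a → 1 ≤ s) → (T b → 1 ≤ s) → 𝟙 a + 𝟙 b ≤ s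
𝟙-disjoint-≤ {true}  {true}  a∧b _  _  = ⊥-elim (a∧b (_ , _))
𝟙-disjoint-≤ {true}  {false} _   ha _  = ha _
𝟙-disjoint-≤ {false} {true}  _   _  hb = hb _
𝟙-disjoint-≤ {false} {false} _   _  _  = z≤n

sum-mono-≤ : ∀ {n} {f g : Fin n → ℕ} → (∀ i → f i ≤ g i) → sum f ≤ sum g
sum-mono-≤ {zero}  f≤g = z≤n
sum-mono-≤ {suc n} f≤g = +-mono-≤ (f≤g zero) (sum-mono-≤ (λ i → f≤g (suc i)))

sum-const : ∀ n c → ∑[ i < n ] c ≡ n * c
sum-const zero    c = refl
sum-const (suc n) c = cong (c +_) (sum-const n c)

sum-point : ∀ {n} (a : Fin n) (f : Fin n → ℕ) → ∑[ i < n ] (𝟙 (does (i ≟ a)) * f i) ≡ f a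
sum-point {suc n} zero    f = trans (cong₂ _+_ (+-identityʳ (f zero)) (sum-replicate-zero n)) (+-identityʳ (f zero))
sum-point {suc n} (suc a) f = sum-point a (λ i → f (suc i))

sum-split-at : ∀ {n} (a : Fin n) (f : Fin n → ℕ) →
  f a + ∑[ i < n ] (𝟙 (not (does (i ≟ a))) * f i) ≡ sum f
sum-split-at {n} a f = begin
  f a + sum miss                 ≡⟨ cong (_+ sum miss) (sum-point a f) ⟨
  sum hit + sum miss             ≡⟨ ∑-distrib-+ hit miss ⟨
  ∑[ i < n ] (hit i + miss i)    ≡⟨ sum-cong-≗ (λ i → 𝟙-split (does (i ≟ a)) (f i)) ⟩
  sum f                          ∎
  where
  open ≡-Reasoning
  hit miss : Fin n → ℕ
  hit  i = 𝟙 (does (i ≟ a)) * f i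
  miss i = 𝟙 (not (does (i ≟ a))) * f i

countTrue≡sum : ∀ {n} (f : Fin n → Bool) → countTrue f ≡ ∑[ i < n ] 𝟙 (f i)
countTrue≡sum {zero}  f = refl
countTrue≡sum {suc n} f with f zero
... | true  = cong suc (countTrue≡sum (λ i → f (suc i)))
... | false = countTrue≡sum (λ i → f (suc i))

∑∑-distrib-+ : ∀ {m n} (f g : Fin m → Fin n → ℕ) →
  ∑[ i < m ] ∑[ j < n ] (f i j + g i j) ≡ ∑[ i < m ] ∑[ j < n ] f i j + ∑[ i < m ] ∑[ j < n ] g i j
∑∑-distrib-+ f g = trans (sum-cong-≗ (λ i → ∑-distrib-+ (f i) (g i)))
                         (∑-distrib-+ (λ i → sum (f i)) (λ i → sum (g i)))

∑-comm₂ : ∀ {a b c d} (f : Fin a → Fin b → Fin c → Fin d → ℕ) →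
  ∑[ w < a ] ∑[ x < b ] ∑[ y < c ] ∑[ z < d ] f w x y z ≡
  ∑[ y < c ] ∑[ z < d ] ∑[ w < a ] ∑[ x < b ] f w x y z
∑-comm₂ {a} {b} {c} {d} f = begin
  ∑[ w < a ] ∑[ x < b ] ∑[ y < c ] ∑[ z < d ] f w x y z
    ≡⟨ sum-cong-≗ (λ w → ∑-comm (λ x y → ∑[ z < d ] f w x y z)) ⟩
  ∑[ w < a ] ∑[ y < c ] ∑[ x < b ] ∑[ z < d ] f w x y z
    ≡⟨ sum-cong-≗ (λ w → sum-cong-≗ (λ y → ∑-comm (λ x z → f w x y z))) ⟩
  ∑[ w < a ] ∑[ y < c ] ∑[ z < d ] ∑[ x < b ] f w x y z
    ≡⟨ ∑-comm (λ w y → ∑[ z < d ] ∑[ x < b ] f w x y z) ⟩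
  ∑[ y < c ] ∑[ w < a ] ∑[ z < d ] ∑[ x < b ] f w x y z
    ≡⟨ sum-cong-≗ (λ y → ∑-comm (λ w z → ∑[ x < b ] f w x y z)) ⟩
  ∑[ y < c ] ∑[ z < d ] ∑[ w < a ] ∑[ x < b ] f w x y z ∎
  where open ≡-Reasoning

module _ {m n : ℕ} (R : Fin m → Fin n → Set) where

  C₄-free : Set
  C₄-free = ∀ {x y L M} → x ≢ y → L ≢ M → R x L → R x M → R y L → R y M → ⊥

  2K₂-free : Set
  2K₂-free = ∀ {a B c D} → R a B → R c D → a ≢ c → B ≢ D → R a D ⊎ R c B

  CoveredBy : Fin m → Fin n → Set
  CoveredBy u v = ∀ {x L} → R x L → x ≡ u ⊎ L ≡ v

  module _ (c4 : C₄-free) (k2 : 2K₂-free) where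

    -- Once two disjoint edges aB and cD are joined by the edge aD, every further edge zK
    -- must meet a or D: otherwise the edges among a, c, z and B, D, K close a 4-cycle.
    covered-by-bridge : ∀ {a B c D} → R a B → R c D → a ≢ c → B ≢ D → R a D → CoveredBy a D
    covered-by-bridge {a} {B} {c} {D} aB cD a≢c B≢D aD {z} {K} zK with z ≟ a | K ≟ D
    ... | yes z≡a | _       = inj₁ z≡a
    ... | no _    | yes K≡D = inj₂ K≡D
    ... | no z≢a  | no K≢D  = ⊥-elim ([ ¬zD , ¬aK ]′ (k2 zK aD z≢a K≢D))
      where
      ¬zD : ¬ R z D
      ¬zD zD with K ≟ B
      ... | yes refl = c4 z≢a B≢D zK zD aB aD
      ... | no K≢B   = [ (λ zB → c4 z≢a B≢D zB zD aB aD) , (λ aK → c4 z≢a K≢D zK zD aK aD) ]′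
                         (k2 zK aB z≢a K≢B)
      ¬aK : ¬ R a K
      ¬aK aK with z ≟ c
      ... | yes refl = ¬zD cD
      ... | no z≢c   = [ ¬zD , (λ cK → c4 (≢-sym a≢c) K≢D cK cD aK aD) ]′ (k2 zK cD z≢c K≢D)

    double-star : (∀ x L → Dec (R x L)) → (∀ x L → ¬ R x L) ⊎ ∃₂ λ u v → R u v × CoveredBy u v
    double-star R? with any? (λ x → any? (λ L → R? x L))
    ... | no no-edge = inj₁ (λ x L xL → no-edge (x , L , xL))
    ... | yes (a , B , aB)
      with any? (λ c → any? (λ D → R? c D ×-dec ¬? (c ≟ a) ×-dec ¬? (D ≟ B)))
    ... | no no-disjoint = inj₂ (a , B , aB , covered)
      where
      covered : CoveredBy a B
      covered {x} {L} xL with x ≟ a | L ≟ B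
      ... | yes x≡a | _       = inj₁ x≡a
      ... | no _    | yes L≡B = inj₂ L≡B
      ... | no x≢a  | no L≢B  = ⊥-elim (no-disjoint (x , L , xL , x≢a , L≢B))
    ... | yes (c , D , cD , c≢a , D≢B) with k2 aB cD (≢-sym c≢a) (≢-sym D≢B)
    ... | inj₁ aD = inj₂ (a , D , aD , covered-by-bridge aB cD (≢-sym c≢a) (≢-sym D≢B) aD)
    ... | inj₂ cB = inj₂ (c , B , cB , covered-by-bridge cD aB c≢a D≢B cB)

module _ {p : ℕ} (P : ProjectivePlane p) where
  open ProjectivePlane P

  private
    N : ℕ
    N = planeSize p

  incidence-C₄-free : C₄-free (λ x L → T (inc x L))
  incidence-C₄-free x≢y L≢M xL xM yL yM with two-lines _ _ L≢M
  ... | _ , _ , unique = x≢y (trans (sym (unique (xL , xM))) (unique (yL , yM)))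

  point-degree-sum : ∀ x → ∑[ L < N ] 𝟙 (inc x L) ≡ suc p
  point-degree-sum x = trans (sym (countTrue≡sum (inc x))) (point-degree x)

  line-size-sum : ∀ L → ∑[ x < N ] 𝟙 (inc x L) ≡ suc p
  line-size-sum L = trans (sym (countTrue≡sum (λ x → inc x L))) (line-size L)

  incidence-count : ∑[ x < N ] ∑[ L < N ] 𝟙 (inc x L) ≡ N * suc p
  incidence-count = trans (sum-cong-≗ point-degree-sum) (sum-const N (suc p))

  star : Fin N → Fin N → Fin N → Fin N → ℕ
  star u v x L = 𝟙 (does (x ≟ u)) * 𝟙 (inc x L)
               + 𝟙 (does (L ≟ v)) * (𝟙 (not (does (x ≟ u))) * 𝟙 (inc x L))

  star-size : ∀ {u v} → T (inc u v) → ∑[ x < N ] ∑[ L < N ] star u v x L ≡ suc p + p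
  star-size {u} {v} uv = begin
    ∑[ x < N ] ∑[ L < N ] star u v x L
      ≡⟨ sum-cong-≗ (λ x → ∑-distrib-+ (through-u x) (on-v x)) ⟩
    ∑[ x < N ] (sum (through-u x) + sum (on-v x))
      ≡⟨ ∑-distrib-+ (λ x → sum (through-u x)) (λ x → sum (on-v x)) ⟩
    ∑[ x < N ] sum (through-u x) + ∑[ x < N ] sum (on-v x)
      ≡⟨ cong₂ _+_ points-of-u points-of-v ⟩
    suc p + p ∎
    where
    open ≡-Reasoning
    through-u on-v : Fin N → Fin N → ℕ
    through-u x L = 𝟙 (does (x ≟ u)) * 𝟙 (inc x L)
    on-v      x L = 𝟙 (does (L ≟ v)) * (𝟙 (not (does (x ≟ u))) * 𝟙 (inc x L))
    points-of-u : ∑[ x < N ] sum (through-u x) ≡ suc p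
    points-of-u = begin
      ∑[ x < N ] sum (through-u x)
        ≡⟨ sum-cong-≗ (λ x → *-distribˡ-sum (𝟙 (does (x ≟ u))) (λ L → 𝟙 (inc x L))) ⟨
      ∑[ x < N ] (𝟙 (does (x ≟ u)) * ∑[ L < N ] 𝟙 (inc x L))
        ≡⟨ sum-point u (λ x → ∑[ L < N ] 𝟙 (inc x L)) ⟩
      ∑[ L < N ] 𝟙 (inc u L)
        ≡⟨ point-degree-sum u ⟩
      suc p ∎
    points-of-v : ∑[ x < N ] sum (on-v x) ≡ p
    points-of-v = suc-injective (begin
      suc (∑[ x < N ] sum (on-v x))
        ≡⟨ cong suc (sum-cong-≗ (λ x → sum-point v (λ L → 𝟙 (not (does (x ≟ u))) * 𝟙 (inc x L)))) ⟩
      1 + others-on-v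
        ≡⟨ cong (_+ others-on-v) (𝟙-T uv) ⟨
      𝟙 (inc u v) + others-on-v
        ≡⟨ sum-split-at u (λ x → 𝟙 (inc x v)) ⟩
      ∑[ x < N ] 𝟙 (inc x v)
        ≡⟨ line-size-sum v ⟩
      suc p ∎)
      where
      others-on-v : ℕ
      others-on-v = ∑[ x < N ] (𝟙 (not (does (x ≟ u))) * 𝟙 (inc x v))

  star-covers : ∀ {u v x L} → T (inc x L) → x ≡ u ⊎ L ≡ v → 1 ≤ star u v x L
  star-covers {u} {v} {x} {L} xL cover with inc x L | x ≟ u | L ≟ v
  ... | true | yes _   | _       = s≤s z≤n
  ... | true | no _    | yes _   = s≤s z≤n
  ... | true | no x≢u  | no L≢v  = ⊥-elim ([ x≢u , L≢v ]′ cover)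

module _ {p : ℕ} (P : ProjectivePlane p) {k : ℕ}
         (col : Fin (planeSize p) ⊎ Fin (planeSize p) → Fin k)
         (avoiding : Is2K2Avoiding (incidenceGraph P) col) where
  open ProjectivePlane P

  private
    N : ℕ
    N = planeSize p

  pointColour lineColour : Fin N → Fin k
  pointColour x = col (inj₁ x)
  lineColour  L = col (inj₂ L)

  Between : Fin k → Fin k → Fin N → Fin N → Set
  Between i j x L = T (inc x L) × InClasses (incidenceGraph P) col i j (inj₁ x)
                                × InClasses (incidenceGraph P) col i j (inj₂ L)

  between? : ∀ i j x L → Dec (Between i j x L)
  between? i j x L = T? (inc x L) ×-dec (pointColour x ≟ i ⊎-dec pointColour x ≟ j)
                                  ×-dec (lineColour L ≟ i ⊎-dec lineColour L ≟ j)

  between-C₄-free : ∀ i j → C₄-free (Between i j)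
  between-C₄-free i j x≢y L≢M xL xM yL yM =
    incidence-C₄-free P x≢y L≢M (proj₁ xL) (proj₁ xM) (proj₁ yL) (proj₁ yM)

  between-2K₂-free : ∀ {i j} → i ≢ j → 2K₂-free (Between i j)
  between-2K₂-free {i} {j} i≢j {a} {B} {c} {D} (aB , a∈ , B∈) (cD , c∈ , D∈) a≢c B≢D
    with T? (inc a D) | T? (inc c B)
  ... | yes aD | _      = inj₁ (aD , a∈ , D∈)
  ... | no _   | yes cB = inj₂ (cB , c∈ , B∈)
  ... | no ¬aD | no ¬cB = ⊥-elim (proj₂ avoiding i j i≢j
        ( inj₁ a , inj₂ B , inj₁ c , inj₂ D , a∈ , B∈ , c∈ , D∈
        , (λ ()) , a≢c ∘ inj₁-injective , (λ ()) , (λ ()) , B≢D ∘ inj₂-injective , (λ ())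
        , aB , cD , (λ ()) , ¬aD , ¬cB , (λ ())))

  coloured : Fin k → Fin k → Fin N → Fin N → Bool
  coloured i j x L = does (i ≟ pointColour x) ∧ (does (j ≟ lineColour L) ∧ inc x L)

  coloured-parts : ∀ {i j x L} → T (coloured i j x L) →
                   i ≡ pointColour x × j ≡ lineColour L × T (inc x L)
  coloured-parts {i} {j} {x} {L} c with i ≟ pointColour x | j ≟ lineColour L | inc x L
  ... | yes i≡x | yes j≡L | true = i≡x , j≡L , _

  coloured⇒between : ∀ {i j x L} → T (coloured i j x L) → Between i j x L
  coloured⇒between {i} {j} {x} {L} c with coloured-parts {i} {j} {x} {L} c
  ... | refl , refl , xL = xL , inj₁ refl , inj₂ refl

  coloured⇒between-swapped : ∀ {i j x L} → T (coloured j i x L) → Between i j x L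
  coloured⇒between-swapped {i} {j} {x} {L} c with coloured-parts {j} {i} {x} {L} c
  ... | refl , refl , xL = xL , inj₂ refl , inj₁ refl

  not-coloured-monochromatic : ∀ {i x L} → ¬ T (coloured i i x L)
  not-coloured-monochromatic {i} {x} {L} c with coloured-parts {i} {i} {x} {L} c
  ... | i≡x , i≡L , xL = proj₁ avoiding (inj₁ _) (inj₂ _) xL (trans (sym i≡x) i≡L)

  not-coloured-both-ways : ∀ {i j x L} → i ≢ j → ¬ (T (coloured i j x L) × T (coloured j i x L))
  not-coloured-both-ways {i} {j} {x} {L} i≢j (cij , cji)
    with coloured-parts {i} {j} {x} {L} cij | coloured-parts {j} {i} {x} {L} cji
  ... | i≡x , _ , _ | j≡x , _ , _ = i≢j (trans i≡x (sym j≡x))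

  incidence-split : ∀ x L → ∑[ i < k ] ∑[ j < k ] 𝟙 (coloured i j x L) ≡ 𝟙 (inc x L)
  incidence-split x L = begin
    ∑[ i < k ] ∑[ j < k ] 𝟙 (coloured i j x L)
      ≡⟨ sum-cong-≗ (λ i → sum-cong-≗ (λ j → unfold i j)) ⟩
    ∑[ i < k ] ∑[ j < k ] (𝟙 (does (i ≟ pointColour x)) * (𝟙 (does (j ≟ lineColour L)) * 𝟙 (inc x L)))
      ≡⟨ sum-cong-≗ (λ i → *-distribˡ-sum (𝟙 (does (i ≟ pointColour x))) on-L) ⟨
    ∑[ i < k ] (𝟙 (does (i ≟ pointColour x)) * sum on-L)
      ≡⟨ sum-point (pointColour x) (λ _ → sum on-L) ⟩
    sum on-L
      ≡⟨ sum-point (lineColour L) (λ _ → 𝟙 (inc x L)) ⟩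
    𝟙 (inc x L) ∎
    where
    open ≡-Reasoning
    on-L : Fin k → ℕ
    on-L j = 𝟙 (does (j ≟ lineColour L)) * 𝟙 (inc x L)
    unfold : ∀ i j → 𝟙 (coloured i j x L) ≡
             𝟙 (does (i ≟ pointColour x)) * (𝟙 (does (j ≟ lineColour L)) * 𝟙 (inc x L))
    unfold i j = trans (𝟙-∧ (does (i ≟ pointColour x)) _)
                       (cong (𝟙 (does (i ≟ pointColour x)) *_) (𝟙-∧ (does (j ≟ lineColour L)) _))

  edges-coloured : Fin k → Fin k → ℕ
  edges-coloured i j = ∑[ x < N ] ∑[ L < N ] 𝟙 (coloured i j x L)

  edges-coloured-monochromatic : ∀ i → edges-coloured i i ≡ 0
  edges-coloured-monochromatic i =
    trans (sum-cong-≗ (λ x → trans (sum-cong-≗ (λ L → 𝟙-F (not-coloured-monochromatic {i} {x} {L})))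
                                   (sum-replicate-zero N)))
          (sum-replicate-zero N)

  edges-between-≤-cover : ∀ {i j} → i ≢ j → (s : Fin N → Fin N → ℕ) →
    (∀ {x L} → Between i j x L → 1 ≤ s x L) →
    edges-coloured i j + edges-coloured j i ≤ ∑[ x < N ] ∑[ L < N ] s x L
  edges-between-≤-cover {i} {j} i≢j s covers = begin
    edges-coloured i j + edges-coloured j i
      ≡⟨ ∑∑-distrib-+ (λ x L → 𝟙 (coloured i j x L)) (λ x L → 𝟙 (coloured j i x L)) ⟨
    ∑[ x < N ] ∑[ L < N ] (𝟙 (coloured i j x L) + 𝟙 (coloured j i x L))
      ≤⟨ sum-mono-≤ {N} (λ x → sum-mono-≤ {N} (λ L →
           𝟙-disjoint-≤ (not-coloured-both-ways i≢j) (covers ∘ coloured⇒between)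
                                                      (covers ∘ coloured⇒between-swapped))) ⟩
    ∑[ x < N ] ∑[ L < N ] s x L ∎
    where open ≤-Reasoning

  edges-between-bound : ∀ {i j} → i ≢ j → edges-coloured i j + edges-coloured j i ≤ suc p + p
  edges-between-bound {i} {j} i≢j
    with double-star (Between i j) (between-C₄-free i j) (between-2K₂-free i≢j) (between? i j)
  ... | inj₁ no-edge = ≤-trans (edges-between-≤-cover i≢j (λ _ _ → 0) (λ {x} {L} b → ⊥-elim (no-edge x L b)))
                               (≤-trans (≤-reflexive zeros) z≤n)
    where
    zeros : ∑[ x < N ] ∑[ L < N ] 0 ≡ 0
    zeros = trans (sum-cong-≗ {N} (λ _ → sum-replicate-zero N)) (sum-replicate-zero N)
  ... | inj₂ (u , v , (uv , _) , covered) =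
    ≤-trans (edges-between-≤-cover i≢j (star P u v) (λ b → star-covers P (proj₁ b) (covered b)))
            (≤-reflexive (star-size P uv))

  incidences-by-colour : N * suc p ≡ ∑[ i < k ] ∑[ j < k ] edges-coloured i j
  incidences-by-colour = begin
    N * suc p
      ≡⟨ incidence-count P ⟨
    ∑[ x < N ] ∑[ L < N ] 𝟙 (inc x L)
      ≡⟨ sum-cong-≗ (λ x → sum-cong-≗ (incidence-split x)) ⟨
    ∑[ x < N ] ∑[ L < N ] ∑[ i < k ] ∑[ j < k ] 𝟙 (coloured i j x L)
      ≡⟨ ∑-comm₂ (λ x L i j → 𝟙 (coloured i j x L)) ⟩
    ∑[ i < k ] ∑[ j < k ] edges-coloured i j ∎
    where open ≡-Reasoning

  -- Padding the diagonal makes the bound uniform over all k² ordered pairs of colours.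
  colour-pair-bound : ∀ i j →
    edges-coloured i j + edges-coloured j i + 𝟙 (does (j ≟ i)) * (suc p + p) ≤ suc p + p
  colour-pair-bound i j with j ≟ i
  ... | yes refl rewrite edges-coloured-monochromatic i = ≤-reflexive (+-identityʳ (suc p + p))
  ... | no j≢i = ≤-trans (≤-reflexive (+-identityʳ _)) (edges-between-bound (≢-sym j≢i))

  double-count : 2 * (N * suc p) + k * (suc p + p) ≤ k * (k * (suc p + p))
  double-count = begin
    2 * (N * suc p) + k * c
      ≡⟨ cong₂ _+_ (cong (N * suc p +_) (+-identityʳ (N * suc p))) diagonal ⟩
    N * suc p + N * suc p + ∑[ i < k ] ∑[ j < k ] pad i j
      ≡⟨ cong (λ E → E + E + sum (sum ∘ pad)) incidences-by-colour ⟩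
    E + E + ∑[ i < k ] ∑[ j < k ] pad i j
      ≡⟨ cong (λ E′ → E + E′ + sum (sum ∘ pad)) (∑-comm edges-coloured) ⟩
    E + ∑[ i < k ] ∑[ j < k ] edges-coloured j i + ∑[ i < k ] ∑[ j < k ] pad i j
      ≡⟨ cong (_+ sum (sum ∘ pad)) (∑∑-distrib-+ edges-coloured (λ i j → edges-coloured j i)) ⟨
    ∑[ i < k ] ∑[ j < k ] (edges-coloured i j + edges-coloured j i) + ∑[ i < k ] ∑[ j < k ] pad i j
      ≡⟨ ∑∑-distrib-+ (λ i j → edges-coloured i j + edges-coloured j i) pad ⟨
    ∑[ i < k ] ∑[ j < k ] (edges-coloured i j + edges-coloured j i + pad i j)
      ≤⟨ sum-mono-≤ {k} (λ i → sum-mono-≤ {k} (colour-pair-bound i)) ⟩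
    ∑[ i < k ] ∑[ j < k ] c
      ≡⟨ trans (sum-cong-≗ {k} (λ _ → sum-const k c)) (sum-const k (k * c)) ⟩
    k * (k * c) ∎
    where
    open ≤-Reasoning
    c : ℕ
    c = suc p + p
    pad : Fin k → Fin k → ℕ
    pad i j = 𝟙 (does (j ≟ i)) * c
    E : ℕ
    E = ∑[ i < k ] ∑[ j < k ] edges-coloured i j
    diagonal : k * c ≡ ∑[ i < k ] ∑[ j < k ] pad i j
    diagonal = sym (trans (sum-cong-≗ {k} (λ i → sum-point i (λ _ → c))) (sum-const k c))

2*suc∸1 : ∀ m → 2 * suc m ∸ 1 ≡ 2 * m + 1
2*suc∸1 m = trans (cong (_∸ 1) (*-suc 2 m)) (+-comm 1 (2 * m))

square-bound : ∀ M c k → 2 * M + k * c ≤ k * (k * c) →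
  4 * (2 * M) ≤ c * ((2 * k ∸ 1) * (2 * k ∸ 1))
square-bound M c zero    h = ≤-trans (*-monoʳ-≤ 4 (m+n≤o⇒m≤o (2 * M) h)) z≤n
square-bound M c (suc m) h rewrite 2*suc∸1 m = +-cancelʳ-≤ (4 * (k * c)) _ _ (begin
  4 * (2 * M) + 4 * (k * c)            ≡⟨ *-distribˡ-+ 4 (2 * M) (k * c) ⟨
  4 * (2 * M + k * c)                  ≤⟨ *-monoʳ-≤ 4 h ⟩
  4 * (k * (k * c))                    ≤⟨ m≤m+n (4 * (k * (k * c))) c ⟩
  4 * (k * (k * c)) + c                ≡⟨ odd-square m c ⟩
  c * ((2 * m + 1) * (2 * m + 1)) + 4 * (k * c) ∎)
  where
  open ≤-Reasoning
  k : ℕ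
  k = suc m
  odd-square : ∀ m c → 4 * (suc m * (suc m * c)) + c ≡ c * ((2 * m + 1) * (2 * m + 1)) + 4 * (suc m * c)
  odd-square = solve-∀

bound-weakening : ∀ p X → 8 * planeSize p * (p + 1) ≤ (2 * p + 1) * X →
  2 * (2 * planeSize p) ≤ X × 2 * planeSize p ≤ (X ∸ 2 * (2 * planeSize p)) * (X ∸ 2 * (2 * planeSize p))
bound-weakening p X h = M≤X , 2N≤gap²
  where
  N M c : ℕ
  N = planeSize p
  M = 2 * (2 * N)
  c = suc (2 * p)
  M+cM≤cX : M + c * M ≤ c * X
  M+cM≤cX = begin
    M + c * M              ≡⟨ split N p ⟨
    8 * N * (p + 1)        ≤⟨ h ⟩
    (2 * p + 1) * X        ≡⟨ cong (_* X) (+-comm (2 * p) 1) ⟩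
    c * X                  ∎
    where
    open ≤-Reasoning
    split : ∀ N p → 8 * N * (p + 1) ≡ 2 * (2 * N) + suc (2 * p) * (2 * (2 * N))
    split = solve-∀
  M≤X : M ≤ X
  M≤X = *-cancelˡ-≤ c (m+n≤o⇒n≤o M M+cM≤cX)
  M≤c*gap : M ≤ c * (X ∸ M)
  M≤c*gap = subst (M ≤_) (sym (*-distribˡ-∸ c X M)) (m+n≤o⇒m≤o∸n M M+cM≤cX)
  c²≤8N : c * c ≤ 8 * N
  c²≤8N = subst (c * c ≤_) (sym (expand p)) (m≤m+n (c * c) _)
    where
    expand : ∀ p → 8 * (p * p + p + 1) ≡ suc (2 * p) * suc (2 * p) + (4 * (p * p) + 4 * p + 7)
    expand = solve-∀
  2N≤gap² : 2 * N ≤ (X ∸ M) * (X ∸ M)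
  2N≤gap² = *-cancelˡ-≤ (c * c) (begin
    c * c * (2 * N)                 ≤⟨ *-monoˡ-≤ (2 * N) c²≤8N ⟩
    8 * N * (2 * N)                 ≡⟨ regroup N ⟩
    M * M                           ≤⟨ *-mono-≤ M≤c*gap M≤c*gap ⟩
    c * (X ∸ M) * (c * (X ∸ M))     ≡⟨ interchange c (X ∸ M) ⟩
    c * c * ((X ∸ M) * (X ∸ M))     ∎)
    where
    open ≤-Reasoning
    regroup : ∀ N → 8 * N * (2 * N) ≡ 2 * (2 * N) * (2 * (2 * N))
    regroup = solve-∀
    interchange : ∀ a b → a * b * (a * b) ≡ a * a * (b * b)
    interchange = solve-∀

corollary5p7 : (p : ℕ) → IsPrimePower p → (P : ProjectivePlane p) →
    χ2K2-satisfies (incidenceGraph P) (λ χ →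
    (8 * planeSize p * (p + 1) ≤ (2 * p + 1) * ((2 * χ ∸ 1) * (2 * χ ∸ 1)))
    × (2 * (2 * planeSize p) ≤ (2 * χ ∸ 1) * (2 * χ ∸ 1))
    × (2 * planeSize p ≤ ((2 * χ ∸ 1) * (2 * χ ∸ 1) ∸ 2 * (2 * planeSize p))
    * ((2 * χ ∸ 1) * (2 * χ ∸ 1) ∸ 2 * (2 * planeSize p))))
corollary5p7 p _ P k col avoiding = main-bound , bound-weakening p _ main-bound
  where
  open ≤-Reasoning
  N : ℕ
  N = planeSize p
  main-bound : 8 * N * (p + 1) ≤ (2 * p + 1) * ((2 * k ∸ 1) * (2 * k ∸ 1))
  main-bound = begin
    8 * N * (p + 1)
      ≡⟨ regroup N p ⟩
    4 * (2 * (N * suc p))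
      ≤⟨ square-bound (N * suc p) (suc p + p) k (double-count P col avoiding) ⟩
    (suc p + p) * ((2 * k ∸ 1) * (2 * k ∸ 1))
      ≡⟨ cong (_* ((2 * k ∸ 1) * (2 * k ∸ 1))) (odd p) ⟩
    (2 * p + 1) * ((2 * k ∸ 1) * (2 * k ∸ 1)) ∎
    where
    regroup : ∀ N p → 8 * N * (p + 1) ≡ 4 * (2 * (N * suc p))
    regroup = solve-∀
    odd : ∀ p → suc p + p ≡ 2 * p + 1
    odd = solve-∀
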